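{- There exists a $BH(19,6)$ matrix, i.e. a $19\times 19$ matrix $H$ whose entries are sixth roots of unity and which satisfies $HH^\ast=19I_{19}$. -}

module Defs where

open import Data.Nat using (ℕ; zero; suc)
open import Data.Integer as ℤ using (ℤ; +_)
open import Data.Fin using (Fin; zero; suc; _≟_)
open import Relation.Nullary using (yes; no)
open import Data.Product using (_×_)
open import Relation.Binary.PropositionalEquality using (_≡_)

-- Eisenstein integers ℤ[ω] with ω = e^{iπ/3} a primitive sixth root of unity,
-- so ω² = ω - 1 and conj ω = ω⁵ = 1 - ω.
-- This ring embeds into ℂ preserving +, *, conjugation, and contains all
-- sixth roots of unity of ℂ (1, ω, ω-1, -1, -ω, 1-ω).
record ℤω : Set where
  constructor _+_ω
  field
    re : ℤ
    im : ℤ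
open ℤω public

0ω : ℤω
0ω = (+ 0) + (+ 0) ω

1ω : ℤω
1ω = (+ 1) + (+ 0) ω

fromℕω : ℕ → ℤω
fromℕω n = (+ n) + (+ 0) ω

infixl 6 _⊕_
infixl 7 _⊗_

_⊕_ : ℤω → ℤω → ℤω
(a + b ω) ⊕ (c + d ω) = (a ℤ.+ c) + (b ℤ.+ d) ω

-- (a + bω)(c + dω) = ac + (ad + bc)ω + bd ω² , with ω² = ω - 1
_⊗_ : ℤω → ℤω → ℤω
(a + b ω) ⊗ (c + d ω) =
  (a ℤ.* c ℤ.- b ℤ.* d) + (a ℤ.* d ℤ.+ b ℤ.* c ℤ.+ b ℤ.* d) ω

-- complex conjugation: conj(a + bω) = a + b(1 - ω) = (a + b) - bω
conj : ℤω → ℤω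
conj (a + b ω) = (a ℤ.+ b) + (ℤ.- b) ω

_^ω_ : ℤω → ℕ → ℤω
x ^ω zero = 1ω
x ^ω suc n = x ⊗ (x ^ω n)

IsSixthRootOfUnity : ℤω → Set
IsSixthRootOfUnity x = x ^ω 6 ≡ 1ω

∑ : (n : ℕ) → (Fin n → ℤω) → ℤω
∑ zero f = 0ω
∑ (suc n) f = f zero ⊕ ∑ n (λ k → f (suc k))

Matrix : ℕ → Set
Matrix n = Fin n → Fin n → ℤω

HH* : (n : ℕ) → Matrix n → Matrix n
HH* n H i j = ∑ n (λ k → H i k ⊗ conj (H j k))

scalarId : (n : ℕ) → ℤω → Matrix n
scalarId n c i j with i ≟ j
... | yes _ = c
... | no _ = 0ω

IsBH6 : (n : ℕ) → Matrix n → Set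
IsBH6 n H =
  ((i j : Fin n) → IsSixthRootOfUnity (H i j)) ×
  ((i j : Fin n) → HH* n H i j ≡ scalarId n (fromℕω n) i j)

-- H is a core of exponents of ω bordered by ones, the core being the
-- two-circulant block matrix [[A, B], [B, A′]] whose block A′ is A with its
-- rows cyclically shifted by one. Entries are powers of ω, hence sixth roots of
-- unity; orthogonality of the rows is an exact identity in ℤ[ω], which has
-- decidable equality, so it is checked by evaluation.
module Submission where

open import Defs
open import Data.Product using (Σ; _,_)
open import Data.Sum using ([_,_]′)
open import Data.Nat as ℕ using (ℕ; suc; _∸_)
open import Data.Nat.DivMod using (_mod_)
open import Data.Integer as ℤ using (+_)
open import Data.Fin using (Fin; zero; suc; toℕ; splitAt)
open import Data.Fin.Properties using (all?)
open import Data.Vec using (Vec; _∷_; []; lookup)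
open import Relation.Binary.PropositionalEquality using (_≡_; refl)
open import Relation.Nullary using (Dec; yes; no)
open import Relation.Nullary.Decidable using (from-yes)

_≟ω_ : (x y : ℤω) → Dec (x ≡ y)
(a + b ω) ≟ω (c + d ω) with a ℤ.≟ c | b ℤ.≟ d
... | yes refl | yes refl = yes refl
... | no a≢c   | _        = no λ { refl → a≢c refl }
... | yes _    | no b≢d   = no λ { refl → b≢d refl }

ω : ℤω
ω = (+ 0) + (+ 1) ω

ω^ω-isSixthRootOfUnity : (k : Fin 6) → IsSixthRootOfUnity (ω ^ω toℕ k)
ω^ω-isSixthRootOfUnity zero                                = refl
ω^ω-isSixthRootOfUnity (suc zero)                          = refl
ω^ω-isSixthRootOfUnity (suc (suc zero))                    = refl
ω^ω-isSixthRootOfUnity (suc (suc (suc zero)))              = refl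
ω^ω-isSixthRootOfUnity (suc (suc (suc (suc zero))))        = refl
ω^ω-isSixthRootOfUnity (suc (suc (suc (suc (suc zero))))) = refl

ω^ : ℕ → ℤω
ω^ k = ω ^ω toℕ (k mod 6)

ω^-isSixthRootOfUnity : (k : ℕ) → IsSixthRootOfUnity (ω^ k)
ω^-isSixthRootOfUnity k = ω^ω-isSixthRootOfUnity (k mod 6)

circulant : ∀ {A : Set} {n} → Vec A (suc n) → Fin (suc n) → Fin (suc n) → A
circulant {n = n} c i j = lookup c ((suc n ℕ.+ toℕ j ∸ toℕ i) mod suc n)

blockMatrix : ∀ {A : Set} m {n} →
              (Fin m → Fin m → A) → (Fin m → Fin n → A) →
              (Fin n → Fin m → A) → (Fin n → Fin n → A) →
              Fin (m ℕ.+ n) → Fin (m ℕ.+ n) → A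
blockMatrix m P Q R S i j =
  [ (λ i′ → [ P i′ , Q i′ ]′ (splitAt m j))
  , (λ i′ → [ R i′ , S i′ ]′ (splitAt m j))
  ]′ (splitAt m i)

bordered : ∀ {A : Set} {n} → A → (Fin n → Fin n → A) → Fin (suc n) → Fin (suc n) → A
bordered x M zero    _       = x
bordered x M (suc i) zero    = x
bordered x M (suc i) (suc j) = M i j

exponents : Fin 19 → Fin 19 → ℕ
exponents = bordered 0 (blockMatrix 9 (circulant a) (circulant b) (circulant b) (circulant a′))
  where
  a a′ b : Vec ℕ 9
  a  = 1 ∷ 5 ∷ 3 ∷ 3 ∷ 4 ∷ 3 ∷ 3 ∷ 5 ∷ 1 ∷ []
  a′ = 1 ∷ 1 ∷ 5 ∷ 3 ∷ 3 ∷ 4 ∷ 3 ∷ 3 ∷ 5 ∷ []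
  b  = 5 ∷ 1 ∷ 3 ∷ 1 ∷ 5 ∷ 5 ∷ 1 ∷ 3 ∷ 1 ∷ []

H : Matrix 19
H i j = ω^ (exponents i j)

H-orthogonal : (i j : Fin 19) → HH* 19 H i j ≡ scalarId 19 (fromℕω 19) i j
H-orthogonal = from-yes (all? λ i → all? λ j → HH* 19 H i j ≟ω scalarId 19 (fromℕω 19) i j)

theorem3p2p9 : Σ (Matrix 19) (λ H → IsBH6 19 H)
theorem3p2p9 = H , (λ i j → ω^-isSixthRootOfUnity (exponents i j)) , H-orthogonal
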